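{- For each integer $n\ge 0$, \[ \sum_{k=0}^n \frac{\binom{2k}{k}\binom{2(n-k)}{n-k}}{(2k+1)(2(n-k)+1)}=\frac{16^n}{(n+1)(2n+1)\binom{2n}{n}}. \] -}

module Defs where

open import Data.Nat using (ℕ; zero; suc; _+_; _*_; _∸_; _^_)
open import Data.Nat.Combinatorics using (_C_)
open import Data.Integer using (+_)
open import Data.Rational using (ℚ; _/_) renaming (_+_ to _+ℚ_)
open import Data.List using (List; map; foldr; upTo)

sumℚ : List ℚ → ℚ
sumℚ = foldr _+ℚ_ (Data.Rational.0ℚ)

central : ℕ → ℕ
central k = (2 * k) C k

-- the k-th summand  binom(2k,k) binom(2(n-k),n-k) / ((2k+1)(2(n-k)+1))
-- denominator written as suc (2k) * suc (2(n-k)) so it is visibly nonzero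
summand : ℕ → ℕ → ℚ
summand n k = (+ (central k * central (n ∸ k))) / (suc (2 * k) * suc (2 * (n ∸ k)))

lhs : ℕ → ℚ
lhs n = sumℚ (map (summand n) (upTo (suc n)))

open import Data.Nat using (_≤_; _<_; z≤n; s≤s; NonZero; >-nonZero)
open import Data.Nat.Properties using (m*n≢0; <-≤-trans; m≤n+m; m≤m+n)
open import Data.Nat.Combinatorics using (nCk+nC[k+1]≡[n+1]C[k+1]; nCn≡1)
open import Relation.Binary.PropositionalEquality using (_≡_; subst; sym)

C-pos : ∀ n k → k ≤ n → 0 < n C k
C-pos n zero _ = s≤s z≤n
C-pos (suc n) (suc k) (s≤s k≤n) =
  subst (0 <_) (nCk+nC[k+1]≡[n+1]C[k+1] n k)
        (<-≤-trans (C-pos n k k≤n) (m≤m+n (n C k) (n C suc k)))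

central-nonZero : ∀ n → NonZero (central n)
central-nonZero n = >-nonZero (C-pos (2 * n) n (m≤m+n n (n + 0)))

rhsDen : ℕ → ℕ
rhsDen n = suc n * suc (2 * n) * central n

rhsDen-nonZero : ∀ n → NonZero (rhsDen n)
rhsDen-nonZero n = m*n≢0 (suc n * suc (2 * n)) (central n) {{_}} {{central-nonZero n}}

rhs : ℕ → ℚ
rhs n = ((+ (16 ^ n)) / rhsDen n) {{rhsDen-nonZero n}}

-- Write C k = binom(2k,k) and W n = Σ_{k ≤ n} C k C (n-k) / (2k+1). Since
-- (2k+1) + (2(n-k)+1) = 2(n+1), each summand of the left-hand side splits into two terms of W,
-- and reversing k ↦ n-k gives 2(n+1) · lhs n = 2 W n. Zeilberger's algorithm supplies the
-- certificate G(n,k) = k C k C (n+1-k) / (n+1), for which the summands w of W satisfy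
-- (2n+3) w(n+1,k) + G(n,k+1) = 8(n+1) w(n,k) + G(n,k); summing over k telescopes to
-- (2n+3) W(n+1) = 8(n+1) W n. By (n+1) C (n+1) = 2(2n+1) C n the closed form 16^n / ((2n+1) C n)
-- satisfies the same recurrence, and both are 1 at n = 0.

module Submission where

open import Defs
open import Data.Nat using (ℕ; zero; suc; _+_; _*_; _∸_; _^_; _≤_; _<_; NonZero; s≤s⁻¹)
import Data.Nat.Properties as ℕ
open import Data.Nat.Combinatorics using (_C_; nCk+nC[k+1]≡[n+1]C[k+1]; nCk≡nC[n∸k]; nC1≡n)
open import Data.Nat.Tactic.RingSolver using (solve; solve-∀)
open import Data.Integer as ℤ using (+_)
import Data.Integer.Properties as ℤ
open import Data.Rational using (ℚ; _/_; 0ℚ; 1ℚ; toℚᵘ; fromℚᵘ) renaming (_+_ to _+ℚ_; _*_ to _*ℚ_)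
import Data.Rational.Properties as ℚ
import Data.Rational.Unnormalised as ℚᵘ
import Data.Rational.Unnormalised.Properties as ℚᵘ
open import Algebra.Bundles using (CommutativeMonoid)
open import Algebra.Properties.Monoid ℚ.*-1-monoid using (cancelˡ; insertˡ)
open import Algebra.Properties.CommutativeSemigroup
  (CommutativeMonoid.commutativeSemigroup ℚ.+-0-commutativeMonoid) using (interchange; xy∙z≈xz∙y)
open import Data.List using ([]; _∷_; map; applyUpTo)
open import Function using (_∘_; id)
open import Relation.Binary.PropositionalEquality

fromℚᵘ-homo-+ : ∀ p q → fromℚᵘ (p ℚᵘ.+ q) ≡ fromℚᵘ p +ℚ fromℚᵘ q
fromℚᵘ-homo-+ p q = ℚ.toℚᵘ-injective (begin
  toℚᵘ (fromℚᵘ (p ℚᵘ.+ q))               ≈⟨ ℚ.toℚᵘ-fromℚᵘ (p ℚᵘ.+ q) ⟩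
  p ℚᵘ.+ q                               ≈⟨ ℚᵘ.+-cong (ℚ.toℚᵘ-fromℚᵘ p) (ℚ.toℚᵘ-fromℚᵘ q) ⟨
  toℚᵘ (fromℚᵘ p) ℚᵘ.+ toℚᵘ (fromℚᵘ q)   ≈⟨ ℚ.toℚᵘ-homo-+ (fromℚᵘ p) (fromℚᵘ q) ⟨
  toℚᵘ (fromℚᵘ p +ℚ fromℚᵘ q)            ∎)
  where open ℚᵘ.≃-Reasoning

fromℚᵘ-homo-* : ∀ p q → fromℚᵘ (p ℚᵘ.* q) ≡ fromℚᵘ p *ℚ fromℚᵘ q
fromℚᵘ-homo-* p q = ℚ.toℚᵘ-injective (begin
  toℚᵘ (fromℚᵘ (p ℚᵘ.* q))               ≈⟨ ℚ.toℚᵘ-fromℚᵘ (p ℚᵘ.* q) ⟩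
  p ℚᵘ.* q                               ≈⟨ ℚᵘ.*-cong (ℚ.toℚᵘ-fromℚᵘ p) (ℚ.toℚᵘ-fromℚᵘ q) ⟨
  toℚᵘ (fromℚᵘ p) ℚᵘ.* toℚᵘ (fromℚᵘ q)   ≈⟨ ℚ.toℚᵘ-homo-* (fromℚᵘ p) (fromℚᵘ q) ⟨
  toℚᵘ (fromℚᵘ p *ℚ fromℚᵘ q)            ∎)
  where open ℚᵘ.≃-Reasoning

-- For b = suc _, + a / b is definitionally fromℚᵘ (+ a ℚᵘ./ b), so fraction arithmetic reduces
-- to the syntactic operations of ℚᵘ.
/-cross : ∀ a b c d .{{_ : NonZero b}} .{{_ : NonZero d}} →
          a * d ≡ c * b → + a / b ≡ + c / d
/-cross a b@(suc _) c d@(suc _) eq =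
  ℚ.fromℚᵘ-cong {+ a ℚᵘ./ b} {+ c ℚᵘ./ d} (ℚᵘ.*≡* (begin
    + a ℤ.* + d  ≡⟨ ℤ.pos-* a d ⟨
    + (a * d)    ≡⟨ cong +_ eq ⟩
    + (c * b)    ≡⟨ ℤ.pos-* c b ⟩
    + c ℤ.* + b  ∎))
  where open ≡-Reasoning

/-+-/ : ∀ a b c d .{{_ : NonZero b}} .{{_ : NonZero d}} →
        + a / b +ℚ + c / d ≡ (+ (a * d + c * b) / (b * d)) {{ℕ.m*n≢0 b d}}
/-+-/ a b@(suc _) c d@(suc _) =
  trans (sym (fromℚᵘ-homo-+ (+ a ℚᵘ./ b) (+ c ℚᵘ./ d)))
        (cong (λ i → fromℚᵘ (i ℚᵘ./ (b * d))) numerator)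
  where
  numerator : + a ℤ.* + d ℤ.+ + c ℤ.* + b ≡ + (a * d + c * b)
  numerator = sym (trans (ℤ.pos-+ (a * d) (c * b)) (cong₂ ℤ._+_ (ℤ.pos-* a d) (ℤ.pos-* c b)))

/-*-/ : ∀ a b c d .{{_ : NonZero b}} .{{_ : NonZero d}} →
        (+ a / b) *ℚ (+ c / d) ≡ (+ (a * c) / (b * d)) {{ℕ.m*n≢0 b d}}
/-*-/ a b@(suc _) c d@(suc _) =
  trans (sym (fromℚᵘ-homo-* (+ a ℚᵘ./ b) (+ c ℚᵘ./ d)))
        (cong (λ i → fromℚᵘ (i ℚᵘ./ (b * d))) (sym (ℤ.pos-* a c)))

ι : ℕ → ℚ
ι n = + n / 1

ι-*-/ : ∀ c a d .{{_ : NonZero d}} → ι c *ℚ (+ a / d) ≡ + (c * a) / d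
ι-*-/ c a d@(suc _) =
  trans (/-*-/ c 1 a d) (/-cross (c * a) (1 * d) (c * a) d (cong (c * a *_) (sym (ℕ.*-identityˡ d))))

ι-*-/-+-/ : ∀ c a b e d .{{_ : NonZero b}} .{{_ : NonZero d}} →
            ι c *ℚ (+ a / b) +ℚ + e / d ≡ (+ (c * a * d + e * b) / (b * d)) {{ℕ.m*n≢0 b d}}
ι-*-/-+-/ c a b e d = trans (cong (_+ℚ + e / d) (ι-*-/ c a b)) (/-+-/ (c * a) b e d)

ι-cancelˡ : ∀ d .{{_ : NonZero d}} {p q} → ι d *ℚ p ≡ ι d *ℚ q → p ≡ q
ι-cancelˡ d@(suc _) {p} {q} eq =
  trans (insertˡ {a = + 1 / d} {c = ι d} inverse p)
        (trans (cong (+ 1 / d *ℚ_) eq) (cancelˡ {a = + 1 / d} {c = ι d} inverse q))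
  where
  inverse : + 1 / d *ℚ ι d ≡ 1ℚ
  inverse = trans (/-*-/ 1 d d 1) (/-cross (1 * d) (d * 1) 1 1 (ℕ.*-assoc 1 d 1))

∑ : ℕ → (ℕ → ℚ) → ℚ
∑ zero    f = 0ℚ
∑ (suc N) f = ∑ N f +ℚ f N

syntax ∑ N (λ k → e) = ∑[ k < N ] e

∑-cons : ∀ N (f : ℕ → ℚ) → ∑ (suc N) f ≡ f 0 +ℚ ∑ N (f ∘ suc)
∑-cons zero    f = ℚ.+-comm 0ℚ (f 0)
∑-cons (suc N) f = trans (cong (_+ℚ f (suc N)) (∑-cons N f)) (ℚ.+-assoc (f 0) _ _)

sumℚ-applyUpTo : ∀ (f : ℕ → ℚ) g N → sumℚ (map f (applyUpTo g N)) ≡ ∑ N (f ∘ g)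
sumℚ-applyUpTo f g zero    = refl
sumℚ-applyUpTo f g (suc N) =
  trans (cong (f (g 0) +ℚ_) (sumℚ-applyUpTo f (g ∘ suc) N)) (sym (∑-cons N (f ∘ g)))

∑-cong : ∀ N {f g : ℕ → ℚ} → (∀ {k} → k < N → f k ≡ g k) → ∑ N f ≡ ∑ N g
∑-cong zero    eq = refl
∑-cong (suc N) eq = cong₂ _+ℚ_ (∑-cong N (eq ∘ ℕ.m<n⇒m<1+n)) (eq (ℕ.n<1+n N))

∑-+ : ∀ N (f g : ℕ → ℚ) → ∑[ k < N ] (f k +ℚ g k) ≡ ∑ N f +ℚ ∑ N g
∑-+ zero    f g = sym (ℚ.+-identityʳ 0ℚ)
∑-+ (suc N) f g = trans (cong (_+ℚ (f N +ℚ g N)) (∑-+ N f g)) (interchange (∑ N f) (∑ N g) (f N) (g N))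

∑-*ˡ : ∀ N c (f : ℕ → ℚ) → ∑[ k < N ] (c *ℚ f k) ≡ c *ℚ ∑ N f
∑-*ˡ zero    c f = sym (ℚ.*-zeroʳ c)
∑-*ˡ (suc N) c f = trans (cong (_+ℚ c *ℚ f N) (∑-*ˡ N c f)) (sym (ℚ.*-distribˡ-+ c _ _))

∑-reverse : ∀ N (f : ℕ → ℚ) → ∑ (suc N) f ≡ ∑[ k < suc N ] f (N ∸ k)
∑-reverse zero    f = refl
∑-reverse (suc N) f = begin
  ∑ (suc N) f +ℚ f (suc N)                     ≡⟨ cong (_+ℚ f (suc N)) (∑-reverse N f) ⟩
  ∑[ k < suc N ] f (N ∸ k) +ℚ f (suc N)        ≡⟨ ℚ.+-comm _ (f (suc N)) ⟩
  f (suc N) +ℚ ∑[ k < suc N ] f (N ∸ k)        ≡⟨ ∑-cons (suc N) (λ k → f (suc N ∸ k)) ⟨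
  ∑[ k < suc (suc N) ] f (suc N ∸ k)           ∎
  where open ≡-Reasoning

∑-telescope : ∀ N {x y h : ℕ → ℚ} → (∀ {k} → k < N → x k +ℚ h (suc k) ≡ y k +ℚ h k) →
              ∑ N x +ℚ h N ≡ ∑ N y +ℚ h 0
∑-telescope zero    step = refl
∑-telescope (suc N) {x} {y} {h} step = begin
  (∑ N x +ℚ x N) +ℚ h (suc N)   ≡⟨ ℚ.+-assoc (∑ N x) (x N) (h (suc N)) ⟩
  ∑ N x +ℚ (x N +ℚ h (suc N))   ≡⟨ cong (∑ N x +ℚ_) (step (ℕ.n<1+n N)) ⟩
  ∑ N x +ℚ (y N +ℚ h N)         ≡⟨ ℚ.+-assoc (∑ N x) (y N) (h N) ⟨
  (∑ N x +ℚ y N) +ℚ h N         ≡⟨ xy∙z≈xz∙y (∑ N x) (y N) (h N) ⟩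
  (∑ N x +ℚ h N) +ℚ y N         ≡⟨ cong (_+ℚ y N) (∑-telescope N (step ∘ ℕ.m<n⇒m<1+n)) ⟩
  (∑ N y +ℚ h 0) +ℚ y N         ≡⟨ xy∙z≈xz∙y (∑ N y) (h 0) (y N) ⟩
  (∑ N y +ℚ y N) +ℚ h 0         ∎
  where open ≡-Reasoning

[k+1]*[n+1]C[k+1]≡[n+1]*nCk : ∀ n k → suc k * (suc n C suc k) ≡ suc n * (n C k)
[k+1]*[n+1]C[k+1]≡[n+1]*nCk zero    zero    = refl
[k+1]*[n+1]C[k+1]≡[n+1]*nCk zero    (suc k) = ℕ.*-zeroʳ (suc (suc k))
[k+1]*[n+1]C[k+1]≡[n+1]*nCk (suc n) zero    =
  trans (ℕ.*-identityˡ _) (trans (nC1≡n (suc (suc n))) (sym (ℕ.*-identityʳ (suc (suc n)))))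
[k+1]*[n+1]C[k+1]≡[n+1]*nCk (suc n) (suc k) = begin
  suc (suc k) * (suc (suc n) C suc (suc k))
    ≡⟨ cong (suc (suc k) *_) (nCk+nC[k+1]≡[n+1]C[k+1] (suc n) (suc k)) ⟨
  suc (suc k) * (suc n C suc k + suc n C suc (suc k))
    ≡⟨ ℕ.*-distribˡ-+ (suc (suc k)) (suc n C suc k) _ ⟩
  suc n C suc k + suc k * (suc n C suc k) + suc (suc k) * (suc n C suc (suc k))
    ≡⟨ cong₂ (λ x y → suc n C suc k + x + y) ([k+1]*[n+1]C[k+1]≡[n+1]*nCk n k)
                                              ([k+1]*[n+1]C[k+1]≡[n+1]*nCk n (suc k)) ⟩
  suc n C suc k + suc n * (n C k) + suc n * (n C suc k)
    ≡⟨ ℕ.+-assoc (suc n C suc k) _ _ ⟩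
  suc n C suc k + (suc n * (n C k) + suc n * (n C suc k))
    ≡⟨ cong (_+_ (suc n C suc k)) (ℕ.*-distribˡ-+ (suc n) (n C k) (n C suc k)) ⟨
  suc n C suc k + suc n * (n C k + n C suc k)
    ≡⟨ cong (λ x → suc n C suc k + suc n * x) (nCk+nC[k+1]≡[n+1]C[k+1] n k) ⟩
  suc (suc n) * (suc n C suc k)
    ∎
  where open ≡-Reasoning

central-suc : ∀ k → suc k * central (suc k) ≡ 2 * suc (2 * k) * central k
central-suc k = begin
  suc k * ((2 * suc k) C suc k)                 ≡⟨ cong (λ n → suc k * (n C suc k)) (ℕ.*-suc 2 k) ⟩
  suc k * (suc (suc (2 * k)) C suc k)           ≡⟨ [k+1]*[n+1]C[k+1]≡[n+1]*nCk (suc (2 * k)) k ⟩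
  suc (suc (2 * k)) * (suc (2 * k) C k)         ≡⟨ cong₂ _*_ (sym (ℕ.*-suc 2 k)) (nCk≡nC[n∸k] k≤2k+1) ⟩
  2 * suc k * (suc (2 * k) C (suc (2 * k) ∸ k)) ≡⟨ cong (λ j → 2 * suc k * (suc (2 * k) C j)) 2k+1∸k≡k+1 ⟩
  2 * suc k * (suc (2 * k) C suc k)             ≡⟨ ℕ.*-assoc 2 (suc k) _ ⟩
  2 * (suc k * (suc (2 * k) C suc k))           ≡⟨ cong (2 *_) ([k+1]*[n+1]C[k+1]≡[n+1]*nCk (2 * k) k) ⟩
  2 * (suc (2 * k) * central k)                 ≡⟨ ℕ.*-assoc 2 (suc (2 * k)) _ ⟨
  2 * suc (2 * k) * central k                   ∎
  where
  open ≡-Reasoning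
  k≤2k : k ≤ 2 * k
  k≤2k = ℕ.m≤m+n k (k + 0)
  k≤2k+1 : k ≤ suc (2 * k)
  k≤2k+1 = ℕ.m≤n⇒m≤1+n k≤2k
  2k+1∸k≡k+1 : suc (2 * k) ∸ k ≡ suc k
  2k+1∸k≡k+1 = trans (ℕ.+-∸-assoc 1 k≤2k) (cong suc (trans (ℕ.m+n∸m≡n k (k + 0)) (ℕ.+-identityʳ k)))

term-recurrence-numerator : ∀ k m {n} a b b' → k + m ≡ n → suc m * b' ≡ 2 * suc (2 * m) * b →
  suc (2 * suc n) * (a * b') * suc n + 2 * suc (2 * k) * a * b * suc (2 * k)
    ≡ 8 * suc n * (a * b) * suc n + k * a * b' * suc (2 * k)
-- The b'-terms of the two sides differ by (3 + 4k + 2m) a (m + 1) b', which the hypothesis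
-- turns into exactly the difference of their b-terms.
term-recurrence-numerator k m a b b' refl b'-rec = begin
  suc (2 * suc (k + m)) * (a * b') * suc (k + m) + 2 * suc (2 * k) * a * b * suc (2 * k)
    ≡⟨ solve (k ∷ m ∷ a ∷ b ∷ b' ∷ []) ⟩
  k * a * b' * suc (2 * k) + (3 + 4 * k + 2 * m) * a * (suc m * b') + 2 * suc (2 * k) * suc (2 * k) * a * b
    ≡⟨ cong (λ x → k * a * b' * suc (2 * k) + (3 + 4 * k + 2 * m) * a * x
                   + 2 * suc (2 * k) * suc (2 * k) * a * b) b'-rec ⟩
  k * a * b' * suc (2 * k) + (3 + 4 * k + 2 * m) * a * (2 * suc (2 * m) * b) + 2 * suc (2 * k) * suc (2 * k) * a * b
    ≡⟨ solve (k ∷ m ∷ a ∷ b ∷ b' ∷ []) ⟩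
  8 * suc (k + m) * (a * b) * suc (k + m) + k * a * b' * suc (2 * k)
    ∎
  where open ≡-Reasoning

summand-split-numerator : ∀ k m {n} a b → k + m ≡ n →
                          2 * suc n * (a * b) ≡ a * b * suc (2 * m) + b * a * suc (2 * k)
summand-split-numerator k m a b refl = solve (k ∷ m ∷ a ∷ b ∷ [])

weightedTerm : ℕ → ℕ → ℚ
weightedTerm n k = + (central k * central (n ∸ k)) / suc (2 * k)

weightedSum : ℕ → ℚ
weightedSum n = ∑[ k < suc n ] weightedTerm n k

certificate : ℕ → ℕ → ℚ
certificate n k = + (k * central k * central (suc n ∸ k)) / suc n

summand-split : ∀ {n k} → k ≤ n →
                ι (2 * suc n) *ℚ summand n k ≡ weightedTerm n k +ℚ weightedTerm n (n ∸ k)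
summand-split {n} {k} k≤n = begin
  ι (2 * suc n) *ℚ summand n k
    ≡⟨ ι-*-/ (2 * suc n) (central k * central m) (suc (2 * k) * suc (2 * m)) ⟩
  + (2 * suc n * (central k * central m)) / (suc (2 * k) * suc (2 * m))
    ≡⟨ cong (λ x → + x / (suc (2 * k) * suc (2 * m)))
            (summand-split-numerator k m (central k) (central m) (ℕ.m+[n∸m]≡n k≤n)) ⟩
  + (central k * central m * suc (2 * m) + central m * central k * suc (2 * k)) / (suc (2 * k) * suc (2 * m))
    ≡⟨ /-+-/ (central k * central m) (suc (2 * k)) (central m * central k) (suc (2 * m)) ⟨
  weightedTerm n k +ℚ + (central m * central k) / suc (2 * m)
    ≡⟨ cong (λ j → weightedTerm n k +ℚ + (central m * central j) / suc (2 * m)) (ℕ.m∸[m∸n]≡n k≤n) ⟨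
  weightedTerm n k +ℚ weightedTerm n m
    ∎
  where
  open ≡-Reasoning
  m = n ∸ k

term-recurrence : ∀ {n k} → k ≤ n →
  ι (suc (2 * suc n)) *ℚ weightedTerm (suc n) k +ℚ certificate n (suc k)
    ≡ ι (8 * suc n) *ℚ weightedTerm n k +ℚ certificate n k
term-recurrence {n} {k} k≤n = begin
  α *ℚ weightedTerm (suc n) k +ℚ certificate n (suc k)
    ≡⟨ cong (λ j → α *ℚ (+ (a * central j) / suc (2 * k)) +ℚ certificate n (suc k)) n+1∸k≡m+1 ⟩
  α *ℚ (+ (a * b') / suc (2 * k)) +ℚ + (suc k * central (suc k) * b) / suc n
    ≡⟨ ι-*-/-+-/ (suc (2 * suc n)) (a * b') (suc (2 * k)) (suc k * central (suc k) * b) (suc n) ⟩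
  + (suc (2 * suc n) * (a * b') * suc n + suc k * central (suc k) * b * suc (2 * k)) / (suc (2 * k) * suc n)
    ≡⟨ cong (λ x → + x / (suc (2 * k) * suc n)) numerator ⟩
  + (8 * suc n * (a * b) * suc n + k * a * b' * suc (2 * k)) / (suc (2 * k) * suc n)
    ≡⟨ ι-*-/-+-/ (8 * suc n) (a * b) (suc (2 * k)) (k * a * b') (suc n) ⟨
  β *ℚ weightedTerm n k +ℚ + (k * a * b') / suc n
    ≡⟨ cong (λ j → β *ℚ weightedTerm n k +ℚ + (k * a * central j) / suc n) n+1∸k≡m+1 ⟨
  β *ℚ weightedTerm n k +ℚ certificate n k
    ∎
  where
  open ≡-Reasoning
  α = ι (suc (2 * suc n))
  β = ι (8 * suc n)
  m = n ∸ k
  a = central k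
  b = central m
  b' = central (suc m)
  n+1∸k≡m+1 : suc n ∸ k ≡ suc m
  n+1∸k≡m+1 = ℕ.+-∸-assoc 1 k≤n
  numerator : suc (2 * suc n) * (a * b') * suc n + suc k * central (suc k) * b * suc (2 * k)
            ≡ 8 * suc n * (a * b) * suc n + k * a * b' * suc (2 * k)
  numerator = trans (cong (λ x → suc (2 * suc n) * (a * b') * suc n + x * b * suc (2 * k)) (central-suc k))
                    (term-recurrence-numerator k m a b b' (ℕ.m+[n∸m]≡n k≤n) (central-suc m))

certificate-top : ∀ n →
  certificate n (suc n) ≡ ι (suc (2 * suc n)) *ℚ weightedTerm (suc n) (suc n)
certificate-top n =
  sym (trans (ι-*-/ c (a * b) c) (/-cross (c * (a * b)) c (suc n * a * b) (suc n) (rearrange c a b (suc n))))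
  where
  c = suc (2 * suc n)
  a = central (suc n)
  b = central (n ∸ n)
  rearrange : ∀ w x y z → w * (x * y) * z ≡ z * x * y * w
  rearrange = solve-∀

weightedSum-recurrence : ∀ n →
  ι (suc (2 * suc n)) *ℚ weightedSum (suc n) ≡ ι (8 * suc n) *ℚ weightedSum n
weightedSum-recurrence n = begin
  α *ℚ (∑ (suc n) (weightedTerm (suc n)) +ℚ weightedTerm (suc n) (suc n))
    ≡⟨ ℚ.*-distribˡ-+ α _ _ ⟩
  α *ℚ ∑ (suc n) (weightedTerm (suc n)) +ℚ α *ℚ weightedTerm (suc n) (suc n)
    ≡⟨ cong₂ _+ℚ_ (∑-*ˡ (suc n) α (weightedTerm (suc n))) (certificate-top n) ⟨
  ∑[ k < suc n ] (α *ℚ weightedTerm (suc n) k) +ℚ certificate n (suc n)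
    ≡⟨ ∑-telescope (suc n) (term-recurrence ∘ s≤s⁻¹) ⟩
  ∑[ k < suc n ] (β *ℚ weightedTerm n k) +ℚ certificate n 0
    ≡⟨ cong (∑[ k < suc n ] (β *ℚ weightedTerm n k) +ℚ_) (ℚ.0/n≡0 (suc n)) ⟩
  ∑[ k < suc n ] (β *ℚ weightedTerm n k) +ℚ 0ℚ
    ≡⟨ ℚ.+-identityʳ _ ⟩
  ∑[ k < suc n ] (β *ℚ weightedTerm n k)
    ≡⟨ ∑-*ˡ (suc n) β (weightedTerm n) ⟩
  β *ℚ weightedSum n
    ∎
  where
  open ≡-Reasoning
  α = ι (suc (2 * suc n))
  β = ι (8 * suc n)

oddCentral : ℕ → ℕ
oddCentral n = suc (2 * n) * central n

oddCentral-nonZero : ∀ n → NonZero (oddCentral n)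
oddCentral-nonZero n = ℕ.m*n≢0 (suc (2 * n)) (central n) {{_}} {{central-nonZero n}}

closedForm : ℕ → ℚ
closedForm n = (+ (16 ^ n) / oddCentral n) {{oddCentral-nonZero n}}

closedForm-recurrence-numerator : ∀ n p c c' → suc n * c' ≡ 2 * suc (2 * n) * c →
  suc (2 * suc n) * (16 * p) * (suc (2 * n) * c) ≡ 8 * suc n * p * (suc (2 * suc n) * c')
closedForm-recurrence-numerator n p c c' c'-rec = begin
  suc (2 * suc n) * (16 * p) * (suc (2 * n) * c) ≡⟨ solve (n ∷ p ∷ c ∷ []) ⟩
  8 * p * suc (2 * suc n) * (2 * suc (2 * n) * c) ≡⟨ cong (8 * p * suc (2 * suc n) *_) c'-rec ⟨
  8 * p * suc (2 * suc n) * (suc n * c')          ≡⟨ solve (n ∷ p ∷ c' ∷ []) ⟩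
  8 * suc n * p * (suc (2 * suc n) * c')          ∎
  where open ≡-Reasoning

closedForm-recurrence : ∀ n →
  ι (suc (2 * suc n)) *ℚ closedForm (suc n) ≡ ι (8 * suc n) *ℚ closedForm n
closedForm-recurrence n =
  trans (ι-*-/ (suc (2 * suc n)) (16 ^ suc n) (oddCentral (suc n)) {{oddCentral-nonZero (suc n)}})
        (trans (/-cross (suc (2 * suc n) * 16 ^ suc n) (oddCentral (suc n)) (8 * suc n * 16 ^ n) (oddCentral n)
                        {{oddCentral-nonZero (suc n)}} {{oddCentral-nonZero n}}
                        (closedForm-recurrence-numerator n (16 ^ n) (central n) (central (suc n)) (central-suc n)))
               (sym (ι-*-/ (8 * suc n) (16 ^ n) (oddCentral n) {{oddCentral-nonZero n}})))

weightedSum≡closedForm : ∀ n → weightedSum n ≡ closedForm n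
weightedSum≡closedForm zero    = refl
weightedSum≡closedForm (suc n) = ι-cancelˡ (suc (2 * suc n)) (begin
  ι (suc (2 * suc n)) *ℚ weightedSum (suc n)  ≡⟨ weightedSum-recurrence n ⟩
  ι (8 * suc n) *ℚ weightedSum n              ≡⟨ cong (ι (8 * suc n) *ℚ_) (weightedSum≡closedForm n) ⟩
  ι (8 * suc n) *ℚ closedForm n               ≡⟨ closedForm-recurrence n ⟨
  ι (suc (2 * suc n)) *ℚ closedForm (suc n)   ∎)
  where open ≡-Reasoning

2[n+1]*lhs≡weightedSum+weightedSum : ∀ n → ι (2 * suc n) *ℚ lhs n ≡ weightedSum n +ℚ weightedSum n
2[n+1]*lhs≡weightedSum+weightedSum n = begin
  ι (2 * suc n) *ℚ lhs n
    ≡⟨ cong (ι (2 * suc n) *ℚ_) (sumℚ-applyUpTo (summand n) id (suc n)) ⟩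
  ι (2 * suc n) *ℚ ∑ (suc n) (summand n)
    ≡⟨ ∑-*ˡ (suc n) (ι (2 * suc n)) (summand n) ⟨
  ∑[ k < suc n ] (ι (2 * suc n) *ℚ summand n k)
    ≡⟨ ∑-cong (suc n) (summand-split ∘ s≤s⁻¹) ⟩
  ∑[ k < suc n ] (weightedTerm n k +ℚ weightedTerm n (n ∸ k))
    ≡⟨ ∑-+ (suc n) (weightedTerm n) (λ k → weightedTerm n (n ∸ k)) ⟩
  weightedSum n +ℚ ∑[ k < suc n ] weightedTerm n (n ∸ k)
    ≡⟨ cong (weightedSum n +ℚ_) (∑-reverse n (weightedTerm n)) ⟨
  weightedSum n +ℚ weightedSum n
    ∎
  where open ≡-Reasoning

2[n+1]*rhs≡closedForm+closedForm : ∀ n → ι (2 * suc n) *ℚ rhs n ≡ closedForm n +ℚ closedForm n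
2[n+1]*rhs≡closedForm+closedForm n =
  trans (ι-*-/ (2 * suc n) (16 ^ n) (rhsDen n) {{rhsDen-nonZero n}})
        (trans (/-cross (2 * suc n * 16 ^ n) (rhsDen n)
                        (16 ^ n * oddCentral n + 16 ^ n * oddCentral n) (oddCentral n * oddCentral n)
                        {{rhsDen-nonZero n}} {{ℕ.m*n≢0 _ _ {{oddCentral-nonZero n}} {{oddCentral-nonZero n}}}}
                        (numerator n (16 ^ n) (central n)))
               (sym (/-+-/ (16 ^ n) (oddCentral n) (16 ^ n) (oddCentral n)
                           {{oddCentral-nonZero n}} {{oddCentral-nonZero n}})))
  where
  numerator : ∀ x p c → 2 * suc x * p * (suc (2 * x) * c * (suc (2 * x) * c))
                      ≡ (p * (suc (2 * x) * c) + p * (suc (2 * x) * c)) * (suc x * suc (2 * x) * c)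
  numerator = solve-∀

theorem8 : (n : ℕ) → lhs n ≡ rhs n
theorem8 n = ι-cancelˡ (2 * suc n) (begin
  ι (2 * suc n) *ℚ lhs n          ≡⟨ 2[n+1]*lhs≡weightedSum+weightedSum n ⟩
  weightedSum n +ℚ weightedSum n  ≡⟨ cong₂ _+ℚ_ (weightedSum≡closedForm n) (weightedSum≡closedForm n) ⟩
  closedForm n +ℚ closedForm n    ≡⟨ 2[n+1]*rhs≡closedForm+closedForm n ⟨
  ι (2 * suc n) *ℚ rhs n          ∎)
  where open ≡-Reasoning
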